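{- Let $q$ be a prime power and let $M$ be a multiset of size $nq$ in $\mathrm{AG}(2,q)$ having exactly 2 special directions. Then $M$ is a union of (not necessarily distinct) lines whose slopes are these special directions.
   Context: Points of $\mathrm{AG}(2,q)$ are the vectors in $\mathbb F_q^2$; lines with slope $d\in\mathbb F_q$ are $Y=dX+b$ and lines with slope $\infty$ are $X+b=0$; directions are $(d)$, $d\in\mathbb F_q\cup\{\infty\}$. Sizes and intersection numbers of multisets count multiplicities. A direction $(d)$ is special for $M$ if not every line of slope $d$ contains $\lfloor|M|/q\rfloor$ or $\lceil|M|/q\rceil$ points of $M$. A union of lines is the multiset where each point has multiplicity the number of lines (counted with repetition) containing it. -}

module Defs where

open import Level using (0ℓ)
open import Algebra.Bundles using (CommutativeRing)
open import Data.Nat using (ℕ; zero; suc; _∸_; NonZero)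
import Data.Nat as N
open import Data.Nat.DivMod using (_/_)
open import Data.Nat.Primality using (Prime)
open import Data.Fin using (Fin)
open import Data.Maybe using (Maybe; just; nothing)
open import Data.List using (List; map; allFin; filter; length)
import Data.List
open import Data.Nat.ListAction using (sum)
open import Data.Product using (_×_; _,_; proj₁; ∃; ∃-syntax)
open import Data.Sum using (_⊎_)
open import Data.Empty using (⊥-elim)
open import Relation.Nullary using (¬_; Dec)
open import Relation.Binary using (Decidable)
open import Relation.Binary.PropositionalEquality using (_≡_)

fin⇒nonZero : ∀ {q} → Fin q → NonZero q
fin⇒nonZero {suc _} _ = _

IsPrimePower : ℕ → Set
IsPrimePower q = ∃[ p ] ∃[ k ] (Prime p × q ≡ p N.^ suc k)

record FiniteField (q : ℕ) : Set₁ where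
  field
    commRing : CommutativeRing 0ℓ 0ℓ
  open CommutativeRing commRing public
  field
    0≉1       : ¬ (0# ≈ 1#)
    inverse   : ∀ x → ¬ (x ≈ 0#) → ∃[ y ] (x * y ≈ 1#)
    _≟_       : Decidable _≈_
    enum      : Fin q → Carrier
    enum-inj  : ∀ i j → enum i ≈ enum j → i ≡ j
    enum-surj : ∀ x → ∃[ i ] (enum i ≈ x)

module AG2 {q : ℕ} (F : FiniteField q) where
  open FiniteField F

  -- q ≠ 0 (Fin 0 is empty but 0# must be enumerated)
  q-nonZero : NonZero q
  q-nonZero = fin⇒nonZero (proj₁ (enum-surj 0#))

  -- Points of AG(2,q): (x , y) ∈ F_q², represented by their indices under enum.
  Point : Set
  Point = Fin q × Fin q

  -- Directions (d), d ∈ F_q ∪ {∞}; nothing = ∞.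
  Direction : Set
  Direction = Maybe (Fin q)

  -- A line: slope d and constant b.
  --   slope d ∈ F_q : Y = d X + b ;   slope ∞ : X + b = 0.
  Line : Set
  Line = Direction × Fin q

  slope : Line → Direction
  slope (d , _) = d

  _∈L_ : Point → Line → Set
  (x , y) ∈L (just d , b)  = enum y ≈ (enum d * enum x) + enum b
  (x , y) ∈L (nothing , b) = enum x + enum b ≈ 0#

  _∈L?_ : (P : Point) → (ℓ : Line) → Dec (P ∈L ℓ)
  (x , y) ∈L? (just d , b)  = enum y ≟ ((enum d * enum x) + enum b)
  (x , y) ∈L? (nothing , b) = (enum x + enum b) ≟ 0#

  Multiset : Set
  Multiset = Point → ℕ

  allPoints : List Point
  allPoints = Data.List.concatMap (λ x → map (λ y → (x , y)) (allFin q)) (allFin q)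

  size : Multiset → ℕ
  size M = sum (map M allPoints)

  _∩L_ : Multiset → Line → ℕ
  M ∩L ℓ = sum (map M (filter (_∈L? ℓ) allPoints))

  ⌊_/q⌋ : ℕ → ℕ
  ⌊ m /q⌋ = _/_ m q {{q-nonZero}}

  ⌈_/q⌉ : ℕ → ℕ
  ⌈ m /q⌉ = _/_ (m N.+ (q ∸ 1)) q {{q-nonZero}}

  Special : Multiset → Direction → Set
  Special M d = ¬ (∀ b → ((M ∩L (d , b)) ≡ ⌊ size M /q⌋) ⊎ ((M ∩L (d , b)) ≡ ⌈ size M /q⌉))

  unionOfLines : List Line → Multiset
  unionOfLines L P = length (filter (P ∈L?_) L)

-- Through a point P pass q + 1 lines, one of each slope; together they cover P
-- q + 1 times and every other point once, so their numbers of points of M add up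
-- to |M| + q·M(P). If |M| = nq, every line of a non-special slope carries exactly
-- n points, so with d₁ and d₂ the only special slopes this becomes
--   q·M(P) + n = A(b₁) + B(b₂),
-- where b₁, b₂ are the intercepts of the lines of slopes d₁, d₂ through P and A, B
-- count the points of M on the lines of these slopes. As lines of slopes d₁ and
-- d₂ meet in exactly one point, M is a function g(b₁, b₂) on a q × q grid, and
-- the identity forces g(b, c) + g(b′, c′) = g(b, c′) + g(b′, c). Subtracting the
-- minimum of one column gives g(b, c) = k₁(b) + k₂(c) with k₁, k₂ ≥ 0, that is,
-- M is k₁(b) copies of each line (d₁, b) plus k₂(c) copies of each line (d₂, c).

module Submission where

open import Defs
open import Algebra.Bundles using (AbelianGroup; CommutativeMonoid)
open import Data.Nat using (ℕ)
import Data.Nat as N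
open import Data.Fin using (Fin)
import Data.Fin.Properties as Fin
open import Data.Maybe using (just; nothing)
open import Data.Maybe.Properties using (just-injective)
open import Data.List
  using (List; []; _∷_; map; filter; length; replicate; concatMap; _++_; allFin; cartesianProduct)
open import Data.List.Relation.Unary.All as All using (All)
import Data.List.Relation.Unary.All.Properties as All
open import Data.List.Relation.Unary.Any using (here; there)
open import Data.List.Membership.Propositional using (_∈_)
open import Data.List.Relation.Unary.Unique.Propositional using (Unique; _∷_)
open import Data.Product using (_×_; _,_; proj₁; proj₂; ∃-syntax; Σ-syntax; ∃!)
open import Data.Product.Properties using (≡-dec)
open import Data.Sum using (_⊎_; inj₁; inj₂; [_,_])
open import Function using (_∘_; _⇔_; mk⇔; Equivalence)
open import Relation.Nullary using (¬_; Dec; yes; no; contradiction)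
open import Relation.Nullary.Decidable using (decidable-stable; _⊎-dec_)
open import Relation.Binary.PropositionalEquality using (_≡_; _≢_)
import Relation.Binary.PropositionalEquality as ≡

module AbelianGroupProperties {a ℓ} (G : AbelianGroup a ℓ) where

  open AbelianGroup G
  open import Relation.Binary.Reasoning.Setoid setoid
  open import Algebra.Properties.AbelianGroup G
    using (x∙y⁻¹≈ε⇒x≈y; x≈y⇒x∙y⁻¹≈ε; ⁻¹-anti-homo‿-)
  open import Algebra.Solver.CommutativeMonoid commutativeMonoid using (solve; _⊕_; _⊜_)

  [p-q]-[r-s]≈[p-r]-[q-s] : ∀ p q r s → (p - q) - (r - s) ≈ (p - r) - (q - s)
  [p-q]-[r-s]≈[p-r]-[q-s] p q r s = begin
    (p - q) - (r - s)   ≈⟨ ∙-congˡ (⁻¹-anti-homo‿- r s) ⟩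
    (p - q) ∙ (s - r)   ≈⟨ solve 4 (λ p q′ s r′ → (p ⊕ q′) ⊕ (s ⊕ r′) ⊜ (p ⊕ r′) ⊕ (s ⊕ q′))
                               refl p (q ⁻¹) s (r ⁻¹) ⟩
    (p - r) ∙ (s - q)   ≈⟨ ∙-congˡ (⁻¹-anti-homo‿- q s) ⟨
    (p - r) - (q - s)   ∎

  p-q≈r-s⇒p-r≈q-s : ∀ {p q r s} → p - q ≈ r - s → p - r ≈ q - s
  p-q≈r-s⇒p-r≈q-s {p} {q} {r} {s} eq =
    x∙y⁻¹≈ε⇒x≈y _ _
      (trans (sym ([p-q]-[r-s]≈[p-r]-[q-s] p q r s)) (x≈y⇒x∙y⁻¹≈ε eq))

module CommutativeMonoidProperties {a ℓ} (M : CommutativeMonoid a ℓ) where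

  open CommutativeMonoid M
  open import Relation.Binary.Reasoning.Setoid setoid

  x∙w≈t⇔x≈t∙u : ∀ {w u} → w ∙ u ≈ ε → ∀ {x t} → x ∙ w ≈ t ⇔ x ≈ t ∙ u
  x∙w≈t⇔x≈t∙u {w} {u} wu≈ε {x} {t} = mk⇔
    (λ xw≈t → begin
      x             ≈⟨ identityʳ x ⟨
      x ∙ ε         ≈⟨ ∙-congˡ wu≈ε ⟨
      x ∙ (w ∙ u)   ≈⟨ assoc x w u ⟨
      x ∙ w ∙ u     ≈⟨ ∙-congʳ xw≈t ⟩
      t ∙ u         ∎)
    (λ x≈tu → begin
      x ∙ w         ≈⟨ ∙-congʳ x≈tu ⟩
      t ∙ u ∙ w     ≈⟨ assoc t u w ⟩
      t ∙ (u ∙ w)   ≈⟨ ∙-congˡ (trans (comm u w) wu≈ε) ⟩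
      t ∙ ε         ≈⟨ identityʳ t ⟩
      t             ∎)

module AffinePlane {q : ℕ} (F : FiniteField q) where

  open FiniteField F
  open AG2 F public
  open import Relation.Binary.Reasoning.Setoid setoid
  open import Algebra.Properties.AbelianGroup +-abelianGroup
    using (x≈z//y; //-rightDividesˡ; //-rightDividesʳ; x∙y⁻¹≈ε⇒x≈y;
           inverseʳ-unique; ⁻¹-injective; ⁻¹-involutive; ∙-cancelʳ)
  open import Algebra.Properties.Ring ring using (x[y-z]≈xy-xz; [y-z]x≈yx-zx)
  open AbelianGroupProperties +-abelianGroup using (p-q≈r-s⇒p-r≈q-s)
  open CommutativeMonoidProperties *-commutativeMonoid using (x∙w≈t⇔x≈t∙u)

  index : Carrier → Fin q
  index c = proj₁ (enum-surj c)

  enum-index : ∀ c → enum (index c) ≈ c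
  enum-index c = proj₂ (enum-surj c)

  index-unique : ∀ {i c} → enum i ≈ c → i ≡ index c
  index-unique {i} {c} eq = enum-inj i (index c) (trans eq (sym (enum-index c)))

  difference-invertible : ∀ {i j} → i ≢ j → ∃[ u ] ((enum i - enum j) * u ≈ 1#)
  difference-invertible {i} {j} i≢j =
    inverse _ (λ eq → i≢j (enum-inj i j (x∙y⁻¹≈ε⇒x≈y _ _ eq)))

  offset : Direction → Point → Carrier
  offset (just d) (x , y) = enum y - enum d * enum x
  offset nothing  (x , _) = - enum x

  intercept : Direction → Point → Fin q
  intercept d P = index (offset d P)

  ∈L⇔≈offset : ∀ P d b → P ∈L (d , b) ⇔ enum b ≈ offset d P
  ∈L⇔≈offset (x , y) (just d) b = mk⇔
    (λ y≈dx+b → x≈z//y _ _ _ (trans (+-comm _ _) (sym y≈dx+b)))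
    (λ b≈y-dx → sym (trans (+-comm _ _) (trans (+-congʳ b≈y-dx) (//-rightDividesˡ _ _))))
  ∈L⇔≈offset (x , y) nothing b = mk⇔
    (inverseʳ-unique _ _)
    (λ b≈-x → trans (+-congˡ b≈-x) (-‿inverseʳ _))

  ∈L⇒≡intercept : ∀ P d {b} → P ∈L (d , b) → b ≡ intercept d P
  ∈L⇒≡intercept P d {b} = index-unique ∘ Equivalence.to (∈L⇔≈offset P d b)

  ∈L-intercept : ∀ d P → P ∈L (d , intercept d P)
  ∈L-intercept d P = Equivalence.from (∈L⇔≈offset P d _) (enum-index (offset d P))

  ∈L-intercept⇔ : ∀ d P Q → Q ∈L (d , intercept d P) ⇔ offset d P ≈ offset d Q
  ∈L-intercept⇔ d P Q = mk⇔
    (λ Q∈ℓ → trans (sym (enum-index _)) (Equivalence.to (∈L⇔≈offset Q d _) Q∈ℓ))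
    (λ eq → Equivalence.from (∈L⇔≈offset Q d _) (trans (enum-index _) eq))

  join : ∀ {P Q} → P ≢ Q → ∃! _≡_ (λ d → offset d P ≈ offset d Q)
  join {x , y} {x′ , y′} P≢Q with x Fin.≟ x′
  ... | yes ≡.refl = nothing , refl , vertical
    where
    vertical : ∀ {d} → offset d (x , y) ≈ offset d (x , y′) → nothing ≡ d
    vertical {nothing} _  = ≡.refl
    vertical {just a}  eq =
      contradiction (≡.cong (x ,_) (enum-inj y y′ (∙-cancelʳ _ _ _ eq))) P≢Q
  ... | no x≢x′ = just (index (t * u)) , Equivalence.from (slope-equation _) on-slope , unique
    where
    w t u : Carrier
    w = enum x - enum x′
    t = enum y - enum y′
    u = proj₁ (difference-invertible x≢x′)
    wu≈1 : w * u ≈ 1#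
    wu≈1 = proj₂ (difference-invertible x≢x′)
    slope-equation : ∀ a →
      offset (just a) (x , y) ≈ offset (just a) (x′ , y′) ⇔ enum a * w ≈ t
    slope-equation a = mk⇔
      (λ eq → trans (x[y-z]≈xy-xz _ _ _) (sym (p-q≈r-s⇒p-r≈q-s eq)))
      (λ aw≈t → p-q≈r-s⇒p-r≈q-s (trans (sym aw≈t) (x[y-z]≈xy-xz _ _ _)))
    on-slope : enum (index (t * u)) * w ≈ t
    on-slope = Equivalence.from (x∙w≈t⇔x≈t∙u wu≈1) (enum-index (t * u))
    unique : ∀ {d} → offset d (x , y) ≈ offset d (x′ , y′) → just (index (t * u)) ≡ d
    unique {nothing} eq = contradiction (enum-inj x x′ (⁻¹-injective eq)) x≢x′
    unique {just a}  eq = ≡.cong just (≡.sym (index-unique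
      (Equivalence.to (x∙w≈t⇔x≈t∙u wu≈1) (Equivalence.to (slope-equation a) eq))))

  meet-exists : ∀ {d₁ d₂} → d₁ ≢ d₂ →
                ∀ c₁ c₂ → ∃[ P ] (offset d₁ P ≈ c₁ × offset d₂ P ≈ c₂)
  meet-exists {nothing} {nothing} d₁≢d₂ _ _ = contradiction ≡.refl d₁≢d₂
  meet-exists {nothing} {just c} _ c₁ c₂ =
    (x , index (c₂ + enum c * enum x)) ,
    trans (-‿cong (enum-index _)) (⁻¹-involutive c₁) ,
    trans (+-congʳ (enum-index _)) (//-rightDividesʳ _ c₂)
    where
    x : Fin q
    x = index (- c₁)
  meet-exists {just a} {nothing} _ c₁ c₂ with meet-exists {nothing} {just a} (λ ()) c₂ c₁
  ... | P , on₂ , on₁ = P , on₁ , on₂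
  meet-exists {just a} {just c} d₁≢d₂ c₁ c₂ =
    (x , index (c₁ + enum a * enum x)) ,
    trans (+-congʳ (enum-index _)) (//-rightDividesʳ _ c₁) ,
    (begin
      enum (index (c₁ + enum a * enum x)) - enum c * enum x   ≈⟨ +-congʳ (enum-index _) ⟩
      c₁ + enum a * enum x - enum c * enum x                  ≈⟨ +-assoc _ _ _ ⟩
      c₁ + (enum a * enum x - enum c * enum x)                ≈⟨ +-congˡ ([y-z]x≈yx-zx _ _ _) ⟨
      c₁ + (enum a - enum c) * enum x                         ≈⟨ +-congˡ (*-comm _ _) ⟩
      c₁ + enum x * (enum a - enum c)
        ≈⟨ +-congˡ (Equivalence.from (x∙w≈t⇔x≈t∙u wu≈1) (enum-index _)) ⟩
      c₁ + (c₂ - c₁)                                          ≈⟨ +-comm _ _ ⟩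
      c₂ - c₁ + c₁                                            ≈⟨ //-rightDividesˡ c₁ c₂ ⟩
      c₂                                                      ∎)
    where
    a≢c : a ≢ c
    a≢c = d₁≢d₂ ∘ ≡.cong just
    u : Carrier
    u = proj₁ (difference-invertible a≢c)
    wu≈1 : (enum a - enum c) * u ≈ 1#
    wu≈1 = proj₂ (difference-invertible a≢c)
    x : Fin q
    x = index ((c₂ - c₁) * u)

  meet-unique : ∀ {d₁ d₂ P Q} → d₁ ≢ d₂ →
                offset d₁ P ≈ offset d₁ Q → offset d₂ P ≈ offset d₂ Q → P ≡ Q
  meet-unique d₁≢d₂ on₁ on₂ = decidable-stable (≡-dec Fin._≟_ Fin._≟_ _ _) λ P≢Q →
    let (_ , _ , unique) = join P≢Q
    in d₁≢d₂ (≡.trans (≡.sym (unique on₁)) (unique on₂))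

  module Meet {d₁ d₂ : Direction} (d₁≢d₂ : d₁ ≢ d₂) where

    private
      meets : ∀ b₁ b₂ → ∃[ P ] (offset d₁ P ≈ enum b₁ × offset d₂ P ≈ enum b₂)
      meets b₁ b₂ = meet-exists d₁≢d₂ (enum b₁) (enum b₂)

    meet : Fin q → Fin q → Point
    meet b₁ b₂ = proj₁ (meets b₁ b₂)

    intercept₁-meet : ∀ b₁ b₂ → intercept d₁ (meet b₁ b₂) ≡ b₁
    intercept₁-meet b₁ b₂ = ≡.sym (index-unique (sym (proj₁ (proj₂ (meets b₁ b₂)))))

    intercept₂-meet : ∀ b₁ b₂ → intercept d₂ (meet b₁ b₂) ≡ b₂
    intercept₂-meet b₁ b₂ = ≡.sym (index-unique (sym (proj₂ (proj₂ (meets b₁ b₂)))))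

    meet-intercepts : ∀ P → meet (intercept d₁ P) (intercept d₂ P) ≡ P
    meet-intercepts P = meet-unique d₁≢d₂
      (trans (proj₁ (proj₂ (meets _ _))) (enum-index _))
      (trans (proj₂ (proj₂ (meets _ _))) (enum-index _))

-- Arithmetic on ℕ is opened only from here on, since its operators and laws share
-- their names with those of the field opened inside AffinePlane.
open import Data.Nat using (zero; suc; _+_; _*_; _∸_; _≤_; NonZero)
open import Data.Nat.Properties
open import Data.Nat.DivMod using (_/_; m*n/n≡m; +-distrib-/-∣ˡ; m<n⇒m/n≡0)
open import Data.Nat.Divisibility using (n∣m*n)
open import Data.Nat.ListAction using (sum)
open import Data.Nat.ListAction.Properties using (sum-++)
open import Data.Nat.Tactic.RingSolver using (solve-∀)
open import Data.List.Properties
  using (map-cong-local; map-++; length-map; length-tabulate; length-++; filter-++)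
open import Data.List.Extrema.Nat using (argmin; f[argmin]≤f[xs])
open import Data.List.Membership.Propositional.Properties
  using (∈-map⁺; ∈-allFin; ∈-cartesianProduct⁺)
open import Data.List.Relation.Unary.Unique.Propositional.Properties
  using (map⁺; allFin⁺; cartesianProduct⁺)
open import Relation.Binary.PropositionalEquality
  using (refl; sym; trans; cong; cong₂; subst; module ≡-Reasoning)

private
  variable
    A B : Set
    x y : A
    xs : List A
    f g : A → ℕ

∑ : List A → (A → ℕ) → ℕ
∑ xs f = sum (map f xs)

infixl 10 ∑
syntax ∑ xs (λ x → e) = ∑[ x ∈ xs ] e

𝟙 : ∀ {P : Set} → Dec P → ℕ
𝟙 (yes _) = 1
𝟙 (no _)  = 0

𝟙-yes : ∀ {P : Set} (P? : Dec P) → P → 𝟙 P? ≡ 1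
𝟙-yes (yes _) _ = refl
𝟙-yes (no ¬p) p = contradiction p ¬p

𝟙-no : ∀ {P : Set} (P? : Dec P) → ¬ P → 𝟙 P? ≡ 0
𝟙-no (yes p) ¬p = contradiction p ¬p
𝟙-no (no _)  _  = refl

∑-cong : ∀ (xs : List A) → (∀ x → f x ≡ g x) → ∑ xs f ≡ ∑ xs g
∑-cong xs f≗g = cong sum (map-cong-local (All.universal f≗g xs))

∑-const : ∀ (xs : List A) c → ∑[ _ ∈ xs ] c ≡ length xs * c
∑-const []       c = refl
∑-const (x ∷ xs) c = cong (c +_) (∑-const xs c)

∑-distrib-+ : ∀ (xs : List A) → ∑[ x ∈ xs ] (f x + g x) ≡ ∑ xs f + ∑ xs g
∑-distrib-+ []                     = refl
∑-distrib-+ {f = f} {g} (x ∷ xs) = begin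
  f x + g x + ∑[ x ∈ xs ] (f x + g x) ≡⟨ cong (f x + g x +_) (∑-distrib-+ xs) ⟩
  f x + g x + (∑ xs f + ∑ xs g)       ≡⟨ +-interchange (f x) (g x) _ _ ⟩
  f x + ∑ xs f + (g x + ∑ xs g)       ∎
  where
  open ≡-Reasoning
  +-interchange : ∀ a b c d → a + b + (c + d) ≡ a + c + (b + d)
  +-interchange = solve-∀

∑-distribʳ-* : ∀ (xs : List A) k → ∑[ x ∈ xs ] (f x * k) ≡ ∑ xs f * k
∑-distribʳ-* []           k = refl
∑-distribʳ-* {f = f} (x ∷ xs) k =
  trans (cong (f x * k +_) (∑-distribʳ-* xs k)) (sym (*-distribʳ-+ k (f x) (∑ xs f)))

∑-comm : ∀ (xs : List A) (ys : List B) (h : A → B → ℕ) →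
         ∑[ x ∈ xs ] ∑[ y ∈ ys ] h x y ≡ ∑[ y ∈ ys ] ∑[ x ∈ xs ] h x y
∑-comm []       ys h = sym (trans (∑-const ys 0) (*-zeroʳ (length ys)))
∑-comm (x ∷ xs) ys h =
  trans (cong (∑ ys (h x) +_) (∑-comm xs ys h)) (sym (∑-distrib-+ ys))

∑-++ : ∀ (xs ys : List A) → ∑ (xs ++ ys) f ≡ ∑ xs f + ∑ ys f
∑-++ {f = f} xs ys = trans (cong sum (map-++ f xs ys)) (sum-++ (map f xs) (map f ys))

∑-concatMap : ∀ (h : A → List B) xs → ∑ (concatMap h xs) g ≡ ∑[ x ∈ xs ] ∑ (h x) g
∑-concatMap h []       = refl
∑-concatMap h (x ∷ xs) = trans (∑-++ (h x) _) (cong (∑ (h x) _ +_) (∑-concatMap h xs))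

∑-replicate : ∀ k (x : A) → ∑ (replicate k x) f ≡ k * f x
∑-replicate zero    x = refl
∑-replicate {f = f} (suc k) x = cong (f x +_) (∑-replicate k x)

∑-filter : ∀ {P : A → Set} (P? : ∀ x → Dec (P x)) xs →
           sum (map f (filter P? xs)) ≡ ∑[ x ∈ xs ] (𝟙 (P? x) * f x)
∑-filter P? [] = refl
∑-filter {f = f} P? (x ∷ xs) with P? x
... | yes _ = cong₂ _+_ (sym (*-identityˡ (f x))) (∑-filter P? xs)
... | no  _ = ∑-filter P? xs

length-filter : ∀ {P : A → Set} (P? : ∀ x → Dec (P x)) xs →
                length (filter P? xs) ≡ ∑[ x ∈ xs ] 𝟙 (P? x)
length-filter P? [] = refl
length-filter P? (x ∷ xs) with P? x
... | yes _ = cong suc (length-filter P? xs)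
... | no  _ = length-filter P? xs

∑-except : Unique xs → x ∈ xs → (∀ {z} → z ∈ xs → z ≢ x → f z ≡ g z) →
           ∑ xs f + g x ≡ ∑ xs g + f x
∑-except {f = f} {g} (x∉zs ∷ _) (here {x = x} {xs = zs} refl) f≡g = begin
  f x + ∑ zs f + g x ≡⟨ cong (λ s → f x + s + g x) ∑zs ⟩
  f x + ∑ zs g + g x ≡⟨ swap (f x) (∑ zs g) (g x) ⟩
  g x + ∑ zs g + f x ∎
  where
  open ≡-Reasoning
  ∑zs : ∑ zs f ≡ ∑ zs g
  ∑zs = cong sum (map-cong-local (All.tabulate λ z∈zs →
    f≡g (there z∈zs) (All.lookup x∉zs z∈zs ∘ sym)))
  swap : ∀ a s b → a + s + b ≡ b + s + a
  swap = solve-∀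
∑-except {x = x} {f = f} {g} (z∉zs ∷ uniq) (there {x = z} {xs = zs} x∈zs) f≡g = begin
  f z + ∑ zs f + g x   ≡⟨ +-assoc (f z) _ _ ⟩
  f z + (∑ zs f + g x) ≡⟨ cong₂ _+_ (f≡g (here refl) (All.lookup z∉zs x∈zs))
                                   (∑-except uniq x∈zs (f≡g ∘ there)) ⟩
  g z + (∑ zs g + f x) ≡⟨ +-assoc (g z) _ _ ⟨
  g z + ∑ zs g + f x   ∎
  where open ≡-Reasoning

∑-single : Unique xs → x ∈ xs → (∀ z → z ≢ x → f z ≡ 0) → ∑ xs f ≡ f x
∑-single {xs = xs} {x = x} {f = f} uniq x∈xs f≡0 = +-cancelʳ-≡ 0 _ _ (begin
  ∑ xs f + 0              ≡⟨ ∑-except uniq x∈xs (λ _ → f≡0 _) ⟩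
  ∑[ _ ∈ xs ] 0 + f x     ≡⟨ cong (_+ f x) (trans (∑-const xs 0) (*-zeroʳ (length xs))) ⟩
  f x                     ≡⟨ +-identityʳ (f x) ⟨
  f x + 0                 ∎)
  where open ≡-Reasoning

private
  ∑-const-except₂-head : ∀ {c zs} → Unique (x ∷ zs) → y ∈ zs →
    (∀ {z} → z ∈ x ∷ zs → z ≢ x → z ≢ y → f z ≡ c) →
    ∑ (x ∷ zs) f + (c + c) ≡ length (x ∷ zs) * c + (f x + f y)
  ∑-const-except₂-head {x = x} {y = y} {f = f} {c} {zs} (x∉zs ∷ uniq) y∈zs f≡c = begin
    f x + ∑ zs f + (c + c)          ≡⟨ regroup₁ (f x) (∑ zs f) c ⟩
    ∑ zs f + c + (f x + c)          ≡⟨ cong (_+ (f x + c)) ∑zs ⟩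
    length zs * c + f y + (f x + c) ≡⟨ regroup₂ (f x) (f y) c (length zs * c) ⟩
    c + length zs * c + (f x + f y) ∎
    where
    open ≡-Reasoning
    ∑zs : ∑ zs f + c ≡ length zs * c + f y
    ∑zs = trans
      (∑-except uniq y∈zs λ z∈zs → f≡c (there z∈zs) (All.lookup x∉zs z∈zs ∘ sym))
      (cong (_+ f y) (∑-const zs c))
    regroup₁ : ∀ a s c → a + s + (c + c) ≡ s + c + (a + c)
    regroup₁ = solve-∀
    regroup₂ : ∀ a b c l → l + b + (a + c) ≡ c + l + (a + b)
    regroup₂ = solve-∀

∑-const-except₂ : ∀ {c} → Unique xs → x ∈ xs → y ∈ xs → x ≢ y →
                  (∀ {z} → z ∈ xs → z ≢ x → z ≢ y → f z ≡ c) →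
                  ∑ xs f + (c + c) ≡ length xs * c + (f x + f y)
∑-const-except₂ _ (here refl) (here refl) x≢y _ = contradiction refl x≢y
∑-const-except₂ uniq (here refl) (there y∈zs) _ f≡c = ∑-const-except₂-head uniq y∈zs f≡c
∑-const-except₂ {x = x} {y = y} {f = f} {c = c} uniq (there {xs = zs} x∈zs) (here refl) _ f≡c =
  trans (∑-const-except₂-head uniq x∈zs (λ z∈xs z≢y z≢x → f≡c z∈xs z≢x z≢y))
        (cong (c + length zs * c +_) (+-comm (f y) (f x)))
∑-const-except₂ {f = f} {c = c} (z∉zs ∷ uniq) (there {x = z} {xs = zs} x∈zs) (there y∈zs) x≢y f≡c =
  trans (+-assoc (f z) (∑ zs f) (c + c))
        (trans (cong₂ _+_ (f≡c (here refl) (All.lookup z∉zs x∈zs) (All.lookup z∉zs y∈zs))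
                          (∑-const-except₂ uniq x∈zs y∈zs x≢y (f≡c ∘ there)))
               (sym (+-assoc c _ _)))

module _ {X Y : Set} (f : X → Y → ℕ) where

  rectangle-rule : ∀ k m (a : X → ℕ) (b : Y → ℕ) .{{_ : NonZero k}} →
                   (∀ x y → k * f x y + m ≡ a x + b y) →
                   ∀ x x′ y y′ → f x y + f x′ y′ ≡ f x y′ + f x′ y
  rectangle-rule k m a b hyp x x′ y y′ =
    *-cancelˡ-≡ _ _ k (+-cancelʳ-≡ (m + m) _ _ (begin
      k * (f x y + f x′ y′) + (m + m)       ≡⟨ distrib k (f x y) (f x′ y′) m ⟩
      (k * f x y + m) + (k * f x′ y′ + m)   ≡⟨ cong₂ _+_ (hyp x y) (hyp x′ y′) ⟩
      (a x + b y) + (a x′ + b y′)           ≡⟨ exchange (a x) (b y) (a x′) (b y′) ⟩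
      (a x + b y′) + (a x′ + b y)           ≡⟨ cong₂ _+_ (hyp x y′) (hyp x′ y) ⟨
      (k * f x y′ + m) + (k * f x′ y + m)   ≡⟨ distrib k (f x y′) (f x′ y) m ⟨
      k * (f x y′ + f x′ y) + (m + m)       ∎))
    where
    open ≡-Reasoning
    distrib : ∀ k u v m → k * (u + v) + (m + m) ≡ (k * u + m) + (k * v + m)
    distrib = solve-∀
    exchange : ∀ a b a′ b′ → (a + b) + (a′ + b′) ≡ (a + b′) + (a′ + b)
    exchange = solve-∀

  additive-split : (∀ x x′ y y′ → f x y + f x′ y′ ≡ f x y′ + f x′ y) →
                   ∀ x₀ y₀ → (∀ x → f x₀ y₀ ≤ f x y₀) →
                   ∀ x y → f x y ≡ (f x y₀ ∸ f x₀ y₀) + f x₀ y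
  additive-split rect x₀ y₀ min x y = +-cancelʳ-≡ (f x₀ y₀) _ _ (begin
    f x y + f x₀ y₀                         ≡⟨ rect x x₀ y y₀ ⟩
    f x y₀ + f x₀ y                         ≡⟨ cong (_+ f x₀ y) (m∸n+n≡m (min x)) ⟨
    (f x y₀ ∸ f x₀ y₀) + f x₀ y₀ + f x₀ y   ≡⟨ swap-last _ (f x₀ y₀) (f x₀ y) ⟩
    (f x y₀ ∸ f x₀ y₀) + f x₀ y + f x₀ y₀   ∎)
    where
    open ≡-Reasoning
    swap-last : ∀ a b c → a + b + c ≡ a + c + b
    swap-last = solve-∀

[m*n+[n∸1]]/n≡m : ∀ m n .{{_ : NonZero n}} → (m * n + (n ∸ 1)) / n ≡ m
[m*n+[n∸1]]/n≡m m (suc k) = begin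
  (m * suc k + k) / suc k         ≡⟨ +-distrib-/-∣ˡ k (n∣m*n m) ⟩
  m * suc k / suc k + k / suc k   ≡⟨ cong₂ _+_ (m*n/n≡m m (suc k)) (m<n⇒m/n≡0 (n<1+n k)) ⟩
  m + 0                           ≡⟨ +-identityʳ m ⟩
  m                               ∎
  where open ≡-Reasoning

concatMap-pairs≡cartesianProduct : ∀ {A B : Set} (xs : List A) (ys : List B) →
  concatMap (λ x → map (λ y → (x , y)) ys) xs ≡ cartesianProduct xs ys
concatMap-pairs≡cartesianProduct []       ys = refl
concatMap-pairs≡cartesianProduct (x ∷ xs) ys =
  cong (map (x ,_) ys ++_) (concatMap-pairs≡cartesianProduct xs ys)

module Counting {q : ℕ} (F : FiniteField q) where

  open AffinePlane F

  directions : List Direction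
  directions = nothing ∷ map just (allFin q)

  directions-unique : Unique directions
  directions-unique =
    All.map⁺ (All.universal (λ _ ()) (allFin q)) ∷ map⁺ just-injective (allFin⁺ q)

  ∈-directions : ∀ d → d ∈ directions
  ∈-directions nothing  = here refl
  ∈-directions (just i) = there (∈-map⁺ just (∈-allFin i))

  length-directions : length directions ≡ suc q
  length-directions = cong suc (trans (length-map just (allFin q)) (length-tabulate (λ i → i)))

  private
    allPoints≡ : allPoints ≡ cartesianProduct (allFin q) (allFin q)
    allPoints≡ = concatMap-pairs≡cartesianProduct (allFin q) (allFin q)

  allPoints-unique : Unique allPoints
  allPoints-unique = subst Unique (sym allPoints≡) (cartesianProduct⁺ (allFin⁺ q) (allFin⁺ q))

  ∈-allPoints : ∀ P → P ∈ allPoints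
  ∈-allPoints (x , y) =
    subst ((x , y) ∈_) (sym allPoints≡) (∈-cartesianProduct⁺ (∈-allFin x) (∈-allFin y))

  concurrence : Point → Point → ℕ
  concurrence P Q = ∑[ d ∈ directions ] 𝟙 (Q ∈L? (d , intercept d P))

  concurrence-self : ∀ P → concurrence P P ≡ suc q
  concurrence-self P = begin
    concurrence P P         ≡⟨ ∑-cong directions on-all ⟩
    ∑[ _ ∈ directions ] 1   ≡⟨ ∑-const directions 1 ⟩
    length directions * 1   ≡⟨ *-identityʳ _ ⟩
    length directions       ≡⟨ length-directions ⟩
    suc q                   ∎
    where
    open ≡-Reasoning
    on-all : ∀ d → 𝟙 (P ∈L? (d , intercept d P)) ≡ 1
    on-all d = 𝟙-yes (P ∈L? (d , intercept d P)) (∈L-intercept d P)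

  concurrence-distinct : ∀ {P Q} → P ≢ Q → concurrence P Q ≡ 1
  concurrence-distinct {P} {Q} P≢Q with join P≢Q
  ... | d₀ , on-d₀ , unique =
    trans (∑-single directions-unique (∈-directions d₀) off-d₀)
          (𝟙-yes (Q ∈L? (d₀ , intercept d₀ P))
                 (Equivalence.from (∈L-intercept⇔ d₀ P Q) on-d₀))
    where
    off-d₀ : ∀ d → d ≢ d₀ → 𝟙 (Q ∈L? (d , intercept d P)) ≡ 0
    off-d₀ d d≢d₀ = 𝟙-no (Q ∈L? (d , intercept d P))
      (d≢d₀ ∘ ≡.sym ∘ unique ∘ Equivalence.to (∈L-intercept⇔ d P Q))

  pencil : ∀ M P → ∑[ d ∈ directions ] M ∩L (d , intercept d P) + M P ≡ size M + suc q * M P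
  pencil M P = begin
    ∑[ d ∈ directions ] M ∩L (d , intercept d P) + M P
      ≡⟨ cong (_+ M P) (∑-cong directions λ d →
           ∑-filter (_∈L? (d , intercept d P)) allPoints) ⟩
    ∑[ d ∈ directions ] ∑[ Q ∈ allPoints ] (on d Q * M Q) + M P
      ≡⟨ cong (_+ M P) (∑-comm directions allPoints _) ⟩
    ∑[ Q ∈ allPoints ] ∑[ d ∈ directions ] (on d Q * M Q) + M P
      ≡⟨ cong (_+ M P) (∑-cong allPoints λ Q →
           ∑-distribʳ-* {f = λ d → on d Q} directions (M Q)) ⟩
    ∑[ Q ∈ allPoints ] (concurrence P Q * M Q) + M P
      ≡⟨ ∑-except allPoints-unique (∈-allPoints P) (λ _ Q≢P → once (Q≢P ∘ ≡.sym)) ⟩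
    size M + concurrence P P * M P
      ≡⟨ cong (λ k → size M + k * M P) (concurrence-self P) ⟩
    size M + suc q * M P
      ∎
    where
    open ≡-Reasoning
    on : Direction → Point → ℕ
    on d Q = 𝟙 (Q ∈L? (d , intercept d P))
    once : ∀ {Q} → P ≢ Q → concurrence P Q * M Q ≡ M Q
    once {Q} P≢Q = trans (cong (_* M Q) (concurrence-distinct P≢Q)) (*-identityˡ (M Q))

  lines-of-non-special : ∀ {M n d} → size M ≡ n * q → ¬ Special M d → ∀ b → M ∩L (d , b) ≡ n
  -- ¬ Special M d is a double negation, eliminated line by line by decidability.
  lines-of-non-special {M} {n} {d} size≡ ¬special b
    with decidable-stable (M ∩L (d , b) ≟ ⌊ size M /q⌋ ⊎-dec M ∩L (d , b) ≟ ⌈ size M /q⌉)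
                          (λ ¬on-b → ¬special (λ on-all → ¬on-b (on-all b)))
  ... | inj₁ on-b = trans on-b (trans (cong ⌊_/q⌋ size≡) (m*n/n≡m n q {{q-nonZero}}))
  ... | inj₂ on-b = trans on-b (trans (cong ⌈_/q⌉ size≡) ([m*n+[n∸1]]/n≡m n q {{q-nonZero}}))

  pencil-two-directions : ∀ {M n d₁ d₂} → d₁ ≢ d₂ → size M ≡ n * q →
    (∀ d → d ≢ d₁ → d ≢ d₂ → ∀ b → M ∩L (d , b) ≡ n) →
    ∀ P → q * M P + n ≡ M ∩L (d₁ , intercept d₁ P) + M ∩L (d₂ , intercept d₂ P)
  pencil-two-directions {M} {n} {d₁} {d₂} d₁≢d₂ size≡ other-lines P =
    +-cancelˡ-≡ (n + q * n) _ _ (begin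
      n + q * n + (q * M P + n)               ≡⟨ regroup n q (M P) ⟩
      n * q + q * M P + (n + n)               ≡⟨ cong (_+ (n + n)) (sym ∑count≡) ⟩
      ∑[ d ∈ directions ] count d + (n + n)
        ≡⟨ ∑-const-except₂ directions-unique (∈-directions d₁) (∈-directions d₂) d₁≢d₂
             (λ {d} _ d≢d₁ d≢d₂ → other-lines d d≢d₁ d≢d₂ (intercept d P)) ⟩
      length directions * n + (count d₁ + count d₂)
        ≡⟨ cong (λ k → k * n + (count d₁ + count d₂)) length-directions ⟩
      n + q * n + (count d₁ + count d₂)       ∎)
    where
    open ≡-Reasoning
    count : Direction → ℕ
    count d = M ∩L (d , intercept d P)
    +-assoc-comm : ∀ a b c → a + (b + c) ≡ a + c + b
    +-assoc-comm = solve-∀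
    ∑count≡ : ∑[ d ∈ directions ] count d ≡ n * q + q * M P
    ∑count≡ = +-cancelʳ-≡ (M P) _ _ (begin
      ∑[ d ∈ directions ] count d + M P   ≡⟨ pencil M P ⟩
      size M + suc q * M P                ≡⟨ cong (_+ suc q * M P) size≡ ⟩
      n * q + (M P + q * M P)             ≡⟨ +-assoc-comm (n * q) (M P) (q * M P) ⟩
      n * q + q * M P + M P               ∎)
    regroup : ∀ n q m → n + q * n + (q * m + n) ≡ n * q + q * m + (n + n)
    regroup = solve-∀

  parallelClass : Direction → (Fin q → ℕ) → List Line
  parallelClass d k = concatMap (λ b → replicate (k b) (d , b)) (allFin q)

  parallelClass-slope : ∀ d k → All (λ ℓ → slope ℓ ≡ d) (parallelClass d k)
  parallelClass-slope d k =
    All.concat⁺ (All.map⁺ (All.universal (λ b → All.replicate⁺ (k b) refl) (allFin q)))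

  unionOfLines-parallelClass : ∀ d k P → unionOfLines (parallelClass d k) P ≡ k (intercept d P)
  unionOfLines-parallelClass d k P = begin
    length (filter (P ∈L?_) (parallelClass d k))
      ≡⟨ length-filter (P ∈L?_) (parallelClass d k) ⟩
    ∑[ ℓ ∈ parallelClass d k ] 𝟙 (P ∈L? ℓ)
      ≡⟨ ∑-concatMap (λ b → replicate (k b) (d , b)) (allFin q) ⟩
    ∑[ b ∈ allFin q ] ∑[ ℓ ∈ replicate (k b) (d , b) ] 𝟙 (P ∈L? ℓ)
      ≡⟨ ∑-cong (allFin q) (λ b → ∑-replicate (k b) (d , b)) ⟩
    ∑[ b ∈ allFin q ] (k b * 𝟙 (P ∈L? (d , b)))
      ≡⟨ ∑-single (allFin⁺ q) (∈-allFin (intercept d P)) off-intercept ⟩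
    k (intercept d P) * 𝟙 (P ∈L? (d , intercept d P))
      ≡⟨ cong (k (intercept d P) *_) (𝟙-yes (P ∈L? (d , intercept d P)) (∈L-intercept d P)) ⟩
    k (intercept d P) * 1
      ≡⟨ *-identityʳ _ ⟩
    k (intercept d P) ∎
    where
    open ≡-Reasoning
    off-intercept : ∀ b → b ≢ intercept d P → k b * 𝟙 (P ∈L? (d , b)) ≡ 0
    off-intercept b b≢ =
      trans (cong (k b *_) (𝟙-no (P ∈L? (d , b)) (b≢ ∘ ∈L⇒≡intercept P d))) (*-zeroʳ (k b))

  unionOfLines-++ : ∀ L L′ P → unionOfLines (L ++ L′) P ≡ unionOfLines L P + unionOfLines L′ P
  unionOfLines-++ L L′ P =
    trans (cong length (filter-++ (P ∈L?_) L L′)) (length-++ (filter (P ∈L?_) L))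

  multiplicity-split : ∀ {M n d₁ d₂} → d₁ ≢ d₂ →
    (∀ P → q * M P + n ≡ M ∩L (d₁ , intercept d₁ P) + M ∩L (d₂ , intercept d₂ P)) →
    Σ[ k₁ ∈ (Fin q → ℕ) ] Σ[ k₂ ∈ (Fin q → ℕ) ]
      ∀ P → M P ≡ k₁ (intercept d₁ P) + k₂ (intercept d₂ P)
  multiplicity-split {M} {n} {d₁} {d₂} d₁≢d₂ pencil-eq =
    (λ b → grid b b₀ ∸ grid bₘ b₀) , grid bₘ ,
    λ P → trans (cong M (sym (meet-intercepts P)))
                (additive-split grid rectangle bₘ b₀ minimal _ _)
    where
    open Meet d₁≢d₂
    grid : Fin q → Fin q → ℕ
    grid b c = M (meet b c)
    rectangle : ∀ b b′ c c′ → grid b c + grid b′ c′ ≡ grid b c′ + grid b′ c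
    rectangle = rectangle-rule grid q n (λ b → M ∩L (d₁ , b)) (λ c → M ∩L (d₂ , c))
      {{q-nonZero}} λ b c → trans (pencil-eq (meet b c))
        (cong₂ (λ b c → M ∩L (d₁ , b) + M ∩L (d₂ , c))
               (intercept₁-meet b c) (intercept₂-meet b c))
    b₀ bₘ : Fin q
    b₀ = index (FiniteField.0# F)
    bₘ = argmin (λ b → grid b b₀) b₀ (allFin q)
    minimal : ∀ b → grid bₘ b₀ ≤ grid b b₀
    minimal b = All.lookup (f[argmin]≤f[xs] b₀ (allFin q)) (∈-allFin b)

  union-of-parallelClasses : ∀ {M : Multiset} {d₁ d₂} k₁ k₂ →
    (∀ P → M P ≡ k₁ (intercept d₁ P) + k₂ (intercept d₂ P)) →
    ∃[ L ] (All (λ ℓ → (slope ℓ ≡ d₁) ⊎ (slope ℓ ≡ d₂)) L × (∀ P → M P ≡ unionOfLines L P))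
  union-of-parallelClasses {d₁ = d₁} {d₂} k₁ k₂ M≡ =
    L₁ ++ L₂ ,
    All.++⁺ (All.map inj₁ (parallelClass-slope d₁ k₁))
            (All.map inj₂ (parallelClass-slope d₂ k₂)) ,
    λ P → trans (M≡ P) (sym (trans (unionOfLines-++ L₁ L₂ P)
      (cong₂ _+_ (unionOfLines-parallelClass d₁ k₁ P) (unionOfLines-parallelClass d₂ k₂ P))))
    where
    L₁ L₂ : List Line
    L₁ = parallelClass d₁ k₁
    L₂ = parallelClass d₂ k₂

proposition3p4 : (q : ℕ) → IsPrimePower q → (F : FiniteField q) →
    let open AG2 F in
    (n : ℕ) (M : Multiset) → size M ≡ n N.* q →
    (d₁ d₂ : Direction) → ¬ (d₁ ≡ d₂) → Special M d₁ → Special M d₂ →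
    (∀ d → Special M d → (d ≡ d₁) ⊎ (d ≡ d₂)) →
    ∃[ L ] (All (λ ℓ → (slope ℓ ≡ d₁) ⊎ (slope ℓ ≡ d₂)) L × (∀ P → M P ≡ unionOfLines L P))
proposition3p4 q _ F n M size≡ d₁ d₂ d₁≢d₂ _ _ only-d₁-d₂-special =
  let (k₁ , k₂ , M≡) = multiplicity-split d₁≢d₂ (pencil-two-directions d₁≢d₂ size≡ other-lines)
  in union-of-parallelClasses k₁ k₂ M≡
  where
  open AG2 F using (_∩L_)
  open Counting F
  other-lines : ∀ d → d ≢ d₁ → d ≢ d₂ → ∀ b → M ∩L (d , b) ≡ n
  other-lines d d≢d₁ d≢d₂ =
    lines-of-non-special {d = d} size≡ ([ d≢d₁ , d≢d₂ ] ∘ only-d₁-d₂-special d)
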